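{- For $|q|<1$, \[ \sum_{i,j,k\geq 0} \frac{q^{i^2+j^2+k^2}}{(q)_{i+j-k} (q)_{i+k-j}(q)_{j+k-i}} = \sum_{i,j\ge0} \frac{q^{i^2+j^2+(i-j)^2}}{(q)_{2i}(q)_{2j}}. \]
   Context: $(q)_n=\prod_{j=1}^n(1-q^j)$ for $n\ge0$, and by convention $1/(q)_n=0$ for $n<0$ (so only triples with $i+j-k,\,i+k-j,\,j+k-i\ge0$ contribute). -}

module Defs where

-- For |q|<1 both sides are convergent power
-- series, so the analytic identity is equivalent to equality of all
-- coefficients of the corresponding formal power series.

open import Data.Nat as ℕ using (ℕ; zero; suc; _∸_; _≡ᵇ_)
open import Data.Integer as ℤ using (ℤ; +_; -[1+_]; 0ℤ; 1ℤ)
open import Data.List using (List; []; _∷_; upTo; map; foldr; zipWith)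
open import Data.Bool using (if_then_else_)

-- A formal power series: n ↦ coefficient of q^n.
Series : Set
Series = ℕ → ℤ

sumℤ : List ℤ → ℤ
sumℤ = foldr ℤ._+_ 0ℤ

Σ≤ : ℕ → (ℕ → ℤ) → ℤ
Σ≤ n f = sumℤ (map f (upTo (suc n)))

zeroS : Series
zeroS _ = 0ℤ

mono : ℕ → Series
mono m n = if m ≡ᵇ n then 1ℤ else 0ℤ

oneS : Series
oneS = mono 0

_-S_ : Series → Series → Series
(f -S g) n = f n ℤ.- g n

_*S_ : Series → Series → Series
(f *S g) n = Σ≤ n (λ k → f k ℤ.* g (n ∸ k))

poch : ℕ → Series
poch zero    = oneS
poch (suc n) = poch n *S (oneS -S mono (suc n))

-- Multiplicative inverse of a power series f with constant term 1:
-- invList f n = [a_n , a_{n-1} , … , a_0]  where a_0 = 1 and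
-- a_{n+1} = - Σ_{k=1}^{n+1} f_k a_{n+1-k}.
invList : Series → ℕ → List ℤ
invList f zero    = 1ℤ ∷ []
invList f (suc n) =
  ℤ.- sumℤ (zipWith ℤ._*_ (map (λ k → f (suc k)) (upTo (suc n))) l) ∷ l
  where l = invList f n

headOr0 : List ℤ → ℤ
headOr0 []      = 0ℤ
headOr0 (x ∷ _) = x

invS : Series → Series
invS f n = headOr0 (invList f n)

-- 1/(q)_m for an integer m, with the convention 1/(q)_m = 0 for m < 0.
rpoch : ℤ → Series
rpoch (+ n)    = invS (poch n)
rpoch -[1+ n ] = zeroS

-- In both identities the
-- (i,j,k)-term (resp. (i,j)-term) is q^e times a power series with e ≥ i,j,k,
-- so the coefficient of q^N only receives contributions from indices ≤ N;
-- the formal (q-adically convergent) sum is therefore given coefficientwise by: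
Σ³ : (ℕ → ℕ → ℕ → Series) → Series
Σ³ t N = Σ≤ N (λ i → Σ≤ N (λ j → Σ≤ N (λ k → t i j k N)))

Σ² : (ℕ → ℕ → Series) → Series
Σ² t N = Σ≤ N (λ i → Σ≤ N (λ j → t i j N))

dist : ℕ → ℕ → ℕ
dist i j = (i ∸ j) ℕ.+ (j ∸ i)

sq : ℕ → ℕ
sq n = n ℕ.* n

lhsTerm : ℕ → ℕ → ℕ → Series
lhsTerm i j k =
  mono (sq i ℕ.+ sq j ℕ.+ sq k)
    *S (rpoch (+ i ℤ.+ + j ℤ.- + k)
    *S (rpoch (+ i ℤ.+ + k ℤ.- + j)
    *S  rpoch (+ j ℤ.+ + k ℤ.- + i)))

rhsTerm : ℕ → ℕ → Series
rhsTerm i j =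
  mono (sq i ℕ.+ sq j ℕ.+ sq (dist i j))
    *S (rpoch (+ (2 ℕ.* i)) *S rpoch (+ (2 ℕ.* j)))

LHS : Series
LHS = Σ³ lhsTerm

RHS : Series
RHS = Σ² rhsTerm

-- Fix i ≥ j and write i = j + d.  Only k = d + t with 0 ≤ t ≤ 2j contribute to the inner sum,
-- which becomes q^(i²+j²+d²) Σ_t q^(t²+2dt) / ((q)_{2j-t} (q)_{2d+t} (q)_t).  By the
-- q-Chu–Vandermonde type identity
--   Σ_{t ≤ n} q^(t²+et) / ((q)_{n-t} (q)_{e+t} (q)_t) = 1 / ((q)_n (q)_{n+e})
-- this is the (i, j) term of the right-hand side.  The identity is proved by induction on n in
-- any commutative semiring, using only 1/(q)_{m+1} = 1/(q)_m + q^(m+1)/(q)_{m+1} and the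
-- uniqueness of solutions of x = a + q^(m+1) x: splitting each reciprocal in a term of the
-- sum S(n+1, e) by that recurrence shows that S(n+1, e) and 1/((q)_{n+1} (q)_{n+1+e}) both
-- solve x = S(n, e+1) + q^(n+1) x.

module Submission where

open import Algebra.Bundles using (Semiring; CommutativeMonoid; CommutativeSemiring)
open import Algebra.Structures using (IsCommutativeSemiring)
import Algebra.Construct.Pointwise as Pointwise
import Algebra.Properties.Semiring.Exp as Exp
import Algebra.Properties.Semiring.Sum as SemiringSum
open import Data.Fin.Properties using (toℕ<n; toℕ-inject₁; toℕ-fromℕ)
open import Data.Integer as ℤ using (ℤ; +_; 0ℤ; 1ℤ)
import Data.Integer.Properties as ℤP
open import Data.Integer.Tactic.RingSolver using (solve-∀)
open import Data.Nat.Tactic.RingSolver using () renaming (solve-∀ to ℕ-solve-∀)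
open import Data.List using (_∷_; applyUpTo; upTo; map; zipWith)
open import Data.Nat as ℕ using (ℕ; zero; suc; _∸_; _≤_; _<_; s≤s)
import Data.Nat.Properties as ℕP
open import Data.Nat.Induction using (<-rec)
open import Data.Fin using (toℕ)
open import Data.Product using (_,_)
open import Data.Sum using (inj₁; inj₂)
open import Data.List.Properties using (map-cong)
open import Level using (0ℓ)
import Relation.Binary.Reasoning.Setoid as SetoidReasoning
open import Function using (_∘_; id)

open import Defs

module RangeSum {c ℓ} (S : Semiring c ℓ) where

  open Semiring S
  open import Relation.Binary.PropositionalEquality using (cong)
  open SemiringSum S
    using (sum; sum-cong-≋; sum-cong-≗; sum-replicate-zero; sum-init-last; ∑-distrib-+; *-distribˡ-sum)

  Σ< : ℕ → (ℕ → Carrier) → Carrier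
  Σ< n f = sum {n} (f ∘ toℕ)

  Σ<-cong : ∀ n {f g} → (∀ k → k < n → f k ≈ g k) → Σ< n f ≈ Σ< n g
  Σ<-cong n f≈g = sum-cong-≋ (λ i → f≈g (toℕ i) (toℕ<n i))

  Σ<-zero : ∀ n {f} → (∀ k → k < n → f k ≈ 0#) → Σ< n f ≈ 0#
  Σ<-zero n f≈0 = trans (Σ<-cong n f≈0) (sum-replicate-zero n)

  Σ<-distrib-+ : ∀ n f g → Σ< n (λ k → f k + g k) ≈ Σ< n f + Σ< n g
  Σ<-distrib-+ n f g = ∑-distrib-+ {n} (f ∘ toℕ) (g ∘ toℕ)

  *-distribˡ-Σ< : ∀ n x f → x * Σ< n f ≈ Σ< n (λ k → x * f k)
  *-distribˡ-Σ< n x f = *-distribˡ-sum {n} x (f ∘ toℕ)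

  Σ<-last : ∀ n f → Σ< (suc n) f ≈ Σ< n f + f n
  Σ<-last n f = trans (sum-init-last {n} (f ∘ toℕ))
    (+-cong (reflexive (sum-cong-≗ {n} (cong f ∘ toℕ-inject₁))) (reflexive (cong f (toℕ-fromℕ n))))

  Σ<-split : ∀ m n f → Σ< (m ℕ.+ n) f ≈ Σ< m f + Σ< n (λ k → f (m ℕ.+ k))
  Σ<-split zero    n f = sym (+-identityˡ _)
  Σ<-split (suc m) n f = trans (+-congˡ (Σ<-split m n (f ∘ suc))) (sym (+-assoc _ _ _))

  Σ<-extend : ∀ m n f → (∀ k → m ≤ k → f k ≈ 0#) → Σ< (m ℕ.+ n) f ≈ Σ< m f
  Σ<-extend m n f f≈0 = trans (Σ<-split m n f)
    (trans (+-congˡ (Σ<-zero n (λ k _ → f≈0 (m ℕ.+ k) (ℕP.m≤m+n m k)))) (+-identityʳ _))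

  Σ<-bound-irrelevant : ∀ m n f → (∀ k → m ≤ k → f k ≈ 0#) → (∀ k → n ≤ k → f k ≈ 0#) →
                        Σ< m f ≈ Σ< n f
  Σ<-bound-irrelevant m n f f≈0 f≈0′ = begin
    Σ< m f           ≈⟨ Σ<-extend m n f f≈0 ⟨
    Σ< (m ℕ.+ n) f   ≡⟨ cong (λ l → Σ< l f) (ℕP.+-comm m n) ⟩
    Σ< (n ℕ.+ m) f   ≈⟨ Σ<-extend n m f f≈0′ ⟩
    Σ< n f           ∎
    where open SetoidReasoning setoid

module _ {c ℓ} (M : CommutativeMonoid c ℓ) where

  open CommutativeMonoid M
  open SetoidReasoning setoid

  inverse-unique : ∀ a b b′ → a ∙ b ≈ ε → a ∙ b′ ≈ ε → b ≈ b′
  inverse-unique a b b′ ab≈ε ab′≈ε = begin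
    b             ≈⟨ identityʳ b ⟨
    b ∙ ε         ≈⟨ ∙-congˡ ab′≈ε ⟨
    b ∙ (a ∙ b′)  ≈⟨ assoc b a b′ ⟨
    (b ∙ a) ∙ b′  ≈⟨ ∙-congʳ (trans (comm b a) ab≈ε) ⟩
    ε ∙ b′        ≈⟨ identityˡ b′ ⟩
    b′            ∎

module QChuVandermonde {c ℓ} (S : CommutativeSemiring c ℓ) where

  open CommutativeSemiring S
  open Exp semiring using (_^_; ^-homo-*; ^-congʳ)
  open RangeSum semiring
  open import Algebra.Solver.Ring.NaturalCoefficients.Default S using (solve; _:+_; _:*_; _:=_)
  open import Relation.Binary.PropositionalEquality using (_≡_; cong; cong₂)
  open SetoidReasoning setoid

  module WithReciprocals
    (q : Carrier) (r : ℕ → Carrier)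
    (r-zero : r 0 ≈ 1#)
    (r-suc : ∀ m → r (suc m) ≈ r m + q ^ suc m * r (suc m))
    (fixpoint-unique : ∀ m {a x y} → x ≈ a + q ^ suc m * x → y ≈ a + q ^ suc m * y → x ≈ y)
    where

    -- r↓ m stands for 1/(q)_{m-1}, with the convention 1/(q)_{-1} = 0.
    r↓ : ℕ → Carrier
    r↓ zero    = 0#
    r↓ (suc m) = r m

    r-rec : ∀ m → r m ≈ r↓ m + q ^ m * r m
    r-rec zero    = sym (trans (+-identityˡ _) (*-identityˡ (r 0)))
    r-rec (suc m) = r-suc m

    r-pascal : ∀ a b → r a * r b ≈ r↓ a * r b + q ^ a * r a * r↓ b + q ^ (a ℕ.+ b) * (r a * r b)
    r-pascal a b = begin
      r a * r b                                       ≈⟨ *-congʳ (r-rec a) ⟩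
      (r↓ a + q ^ a * r a) * r b                      ≈⟨ distribʳ (r b) (r↓ a) _ ⟩
      r↓ a * r b + q ^ a * r a * r b                  ≈⟨ +-congˡ (*-congˡ (r-rec b)) ⟩
      r↓ a * r b + q ^ a * r a * (r↓ b + q ^ b * r b) ≈⟨ expand (r↓ a) (r↓ b) (r a) (r b) (q ^ a) (q ^ b) ⟩
      r↓ a * r b + q ^ a * r a * r↓ b + q ^ a * q ^ b * (r a * r b)
                                                      ≈⟨ +-congˡ (*-congʳ (^-homo-* q a b)) ⟨
      r↓ a * r b + q ^ a * r a * r↓ b + q ^ (a ℕ.+ b) * (r a * r b) ∎
      where
      expand : ∀ s t u v x y → s * v + x * u * (t + y * v) ≈ s * v + x * u * t + x * y * (u * v)
      expand = solve 6 (λ s t u v x y → s :* v :+ x :* u :* (t :+ y :* v)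
                                     := s :* v :+ x :* u :* t :+ x :* y :* (u :* v)) refl

    cvTerm : ℕ → ℕ → ℕ → Carrier
    cvTerm n e t = q ^ (t ℕ.* t ℕ.+ e ℕ.* t) * (r (n ∸ t) * (r (e ℕ.+ t) * r t))

    cvSum : ℕ → ℕ → Carrier
    cvSum n e = Σ< (suc n) (cvTerm n e)

    pascalˡ pascalʳ : ℕ → ℕ → ℕ → Carrier
    pascalˡ n e t = q ^ (t ℕ.* t ℕ.+ e ℕ.* t) * (r↓ t * r (suc n ∸ t) * r (e ℕ.+ t))
    pascalʳ n e t = q ^ (t ℕ.* t ℕ.+ e ℕ.* t) * (q ^ t * r t * r↓ (suc n ∸ t) * r (e ℕ.+ t))

    cvTerm-split : ∀ n e t → t ≤ suc n →
      cvTerm (suc n) e t ≈ pascalˡ n e t + pascalʳ n e t + q ^ suc n * cvTerm (suc n) e t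
    cvTerm-split n e t t≤1+n = begin
      M * (A * (B * C))                    ≈⟨ regroup M A B C ⟩
      M * (C * A * B)                      ≈⟨ *-congˡ (*-congʳ (r-pascal t (suc n ∸ t))) ⟩
      M * ((r↓ t * A + q ^ t * C * r↓ (suc n ∸ t) + q ^ (t ℕ.+ (suc n ∸ t)) * (C * A)) * B)
        ≈⟨ *-congˡ (*-congʳ (+-congˡ (*-congʳ (^-congʳ q (ℕP.m+[n∸m]≡n t≤1+n))))) ⟩
      M * ((r↓ t * A + q ^ t * C * r↓ (suc n ∸ t) + q ^ suc n * (C * A)) * B)
        ≈⟨ distribute M A B C (r↓ t) (r↓ (suc n ∸ t)) (q ^ t) (q ^ suc n) ⟩
      pascalˡ n e t + pascalʳ n e t + q ^ suc n * (M * (A * (B * C))) ∎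
      where
      M = q ^ (t ℕ.* t ℕ.+ e ℕ.* t)
      A = r (suc n ∸ t)
      B = r (e ℕ.+ t)
      C = r t
      regroup : ∀ m a b c → m * (a * (b * c)) ≈ m * (c * a * b)
      regroup = solve 4 (λ m a b c → m :* (a :* (b :* c)) := m :* (c :* a :* b)) refl
      distribute : ∀ m a b c c↓ a↓ x y →
        m * ((c↓ * a + x * c * a↓ + y * (c * a)) * b) ≈
        m * (c↓ * a * b) + m * (x * c * a↓ * b) + y * (m * (a * (b * c)))
      distribute = solve 8 (λ m a b c c↓ a↓ x y →
        m :* ((c↓ :* a :+ x :* c :* a↓ :+ y :* (c :* a)) :* b) :=
        m :* (c↓ :* a :* b) :+ m :* (x :* c :* a↓ :* b) :+ y :* (m :* (a :* (b :* c)))) refl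

    pascalˡ-zero : ∀ n e → pascalˡ n e 0 ≈ 0#
    pascalˡ-zero n e = trans (*-congˡ (trans (*-congʳ (zeroˡ _)) (zeroˡ _))) (zeroʳ _)

    pascalʳ-last : ∀ n e → pascalʳ n e (suc n) ≈ 0#
    pascalʳ-last n e = trans (*-congˡ (trans (*-congʳ r↓[n∸n]≈0) (zeroˡ _))) (zeroʳ _)
      where
      r↓[n∸n]≈0 : q ^ suc n * r (suc n) * r↓ (n ∸ n) ≈ 0#
      r↓[n∸n]≈0 = trans (*-congˡ (reflexive (cong r↓ (ℕP.n∸n≡0 n)))) (zeroʳ _)

    pascal-combine : ∀ n e s → s ≤ n → pascalˡ n e (suc s) + pascalʳ n e s ≈ cvTerm n (suc e) s
    pascal-combine n e s s≤n = begin
      q ^ ((suc s) ℕ.* (suc s) ℕ.+ e ℕ.* suc s) * (C * A * r (e ℕ.+ suc s))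
        + q ^ (s ℕ.* s ℕ.+ e ℕ.* s) * (q ^ s * C * r↓ (suc n ∸ s) * B)
        ≡⟨ cong₂ (λ k l → q ^ ((suc s) ℕ.* (suc s) ℕ.+ e ℕ.* suc s) * (C * A * r k)
                          + q ^ (s ℕ.* s ℕ.+ e ℕ.* s) * (q ^ s * C * r↓ l * B))
                 (ℕP.+-suc e s) (ℕP.+-∸-assoc 1 s≤n) ⟩
      q ^ ((suc s) ℕ.* (suc s) ℕ.+ e ℕ.* suc s) * (C * A * B′)
        + q ^ (s ℕ.* s ℕ.+ e ℕ.* s) * (q ^ s * C * A * B)
        ≈⟨ +-cong (*-congʳ exponentˡ) (trans (regroup _ _ C A B) (*-congʳ exponentʳ)) ⟩
      M * x * (C * A * B′) + M * (C * A * B)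
        ≈⟨ collect M x A B B′ C ⟩
      M * (A * ((B + x * B′) * C))        ≈⟨ *-congˡ (*-congˡ (*-congʳ (sym (r-suc (e ℕ.+ s))))) ⟩
      M * (A * (B′ * C))                   ∎
      where
      M  = q ^ (s ℕ.* s ℕ.+ suc e ℕ.* s)
      x  = q ^ suc (e ℕ.+ s)
      A  = r (n ∸ s)
      B  = r (e ℕ.+ s)
      B′ = r (suc (e ℕ.+ s))
      C  = r s
      exponentˡ : q ^ ((suc s) ℕ.* (suc s) ℕ.+ e ℕ.* suc s) ≈ M * x
      exponentˡ = trans (^-congʳ q (arith e s)) (^-homo-* q (s ℕ.* s ℕ.+ suc e ℕ.* s) (suc (e ℕ.+ s)))
        where
        arith : ∀ e s → suc s ℕ.* suc s ℕ.+ e ℕ.* suc s ≡ (s ℕ.* s ℕ.+ suc e ℕ.* s) ℕ.+ suc (e ℕ.+ s)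
        arith = ℕ-solve-∀
      exponentʳ : q ^ (s ℕ.* s ℕ.+ e ℕ.* s) * q ^ s ≈ M
      exponentʳ = trans (sym (^-homo-* q (s ℕ.* s ℕ.+ e ℕ.* s) s)) (^-congʳ q (arith e s))
        where
        arith : ∀ e s → (s ℕ.* s ℕ.+ e ℕ.* s) ℕ.+ s ≡ s ℕ.* s ℕ.+ suc e ℕ.* s
        arith = ℕ-solve-∀
      regroup : ∀ m y c a b → m * (y * c * a * b) ≈ m * y * (c * a * b)
      regroup = solve 5 (λ m y c a b → m :* (y :* c :* a :* b) := m :* y :* (c :* a :* b)) refl
      collect : ∀ m x a b b′ c → m * x * (c * a * b′) + m * (c * a * b) ≈ m * (a * ((b + x * b′) * c))
      collect = solve 6 (λ m x a b b′ c → m :* x :* (c :* a :* b′) :+ m :* (c :* a :* b)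
                                       := m :* (a :* ((b :+ x :* b′) :* c))) refl

    pascal-sum : ∀ n e →
      Σ< (suc (suc n)) (pascalˡ n e) + Σ< (suc (suc n)) (pascalʳ n e) ≈ cvSum n (suc e)
    pascal-sum n e = begin
      (pascalˡ n e 0 + Σ< (suc n) (pascalˡ n e ∘ suc)) + Σ< (suc (suc n)) (pascalʳ n e)
        ≈⟨ +-cong (trans (+-congʳ (pascalˡ-zero n e)) (+-identityˡ _))
                  (trans (Σ<-last (suc n) (pascalʳ n e)) (trans (+-congˡ (pascalʳ-last n e)) (+-identityʳ _))) ⟩
      Σ< (suc n) (pascalˡ n e ∘ suc) + Σ< (suc n) (pascalʳ n e)
        ≈⟨ Σ<-distrib-+ (suc n) (pascalˡ n e ∘ suc) (pascalʳ n e) ⟨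
      Σ< (suc n) (λ s → pascalˡ n e (suc s) + pascalʳ n e s)
        ≈⟨ Σ<-cong (suc n) (λ s s<1+n → pascal-combine n e s (ℕP.≤-pred s<1+n)) ⟩
      cvSum n (suc e) ∎

    cvSum-step : ∀ n e → cvSum (suc n) e ≈ cvSum n (suc e) + q ^ suc n * cvSum (suc n) e
    cvSum-step n e = begin
      Σ< (suc (suc n)) T
        ≈⟨ Σ<-cong (suc (suc n)) (λ t t<2+n → cvTerm-split n e t (ℕP.≤-pred t<2+n)) ⟩
      Σ< (suc (suc n)) (λ t → pascalˡ n e t + pascalʳ n e t + q ^ suc n * T t)
        ≈⟨ Σ<-distrib-+ (suc (suc n)) (λ t → pascalˡ n e t + pascalʳ n e t) (λ t → q ^ suc n * T t) ⟩
      Σ< (suc (suc n)) (λ t → pascalˡ n e t + pascalʳ n e t) + Σ< (suc (suc n)) (λ t → q ^ suc n * T t)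
        ≈⟨ +-cong (Σ<-distrib-+ (suc (suc n)) (pascalˡ n e) (pascalʳ n e))
                  (sym (*-distribˡ-Σ< (suc (suc n)) (q ^ suc n) T)) ⟩
      Σ< (suc (suc n)) (pascalˡ n e) + Σ< (suc (suc n)) (pascalʳ n e) + q ^ suc n * Σ< (suc (suc n)) T
        ≈⟨ +-congʳ (pascal-sum n e) ⟩
      cvSum n (suc e) + q ^ suc n * cvSum (suc n) e ∎
      where
      T = cvTerm (suc n) e

    cvSum-closed : ∀ n e → cvSum n e ≈ r n * r (n ℕ.+ e)
    cvSum-closed zero e = begin
      q ^ (e ℕ.* 0) * (r 0 * (r (e ℕ.+ 0) * r 0)) + 0#   ≈⟨ +-identityʳ _ ⟩
      q ^ (e ℕ.* 0) * (r 0 * (r (e ℕ.+ 0) * r 0))        ≈⟨ *-congʳ (^-congʳ q (ℕP.*-zeroʳ e)) ⟩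
      1# * (r 0 * (r (e ℕ.+ 0) * r 0))                   ≈⟨ *-identityˡ _ ⟩
      r 0 * (r (e ℕ.+ 0) * r 0)                          ≡⟨ cong (λ k → r 0 * (r k * r 0)) (ℕP.+-identityʳ e) ⟩
      r 0 * (r e * r 0)                                  ≈⟨ *-congˡ (trans (*-congˡ r-zero) (*-identityʳ (r e))) ⟩
      r 0 * r e                                          ∎
    cvSum-closed (suc n) e = fixpoint-unique n
      (trans (cvSum-step n e) (+-congʳ (trans (cvSum-closed n (suc e)) reindex)))
      (trans (*-congʳ (r-suc n)) (trans (distribʳ _ _ _) (+-congˡ (*-assoc _ _ _))))
      where
      reindex : r n * r (n ℕ.+ suc e) ≈ r n * r (suc n ℕ.+ e)
      reindex = reflexive (cong (λ k → r n * r k) (ℕP.+-suc n e))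

open import Relation.Binary.PropositionalEquality
  using (_≡_; _≗_; refl; sym; trans; cong; cong₂; cong-app; subst; module ≡-Reasoning)

open RangeSum ℤP.+-*-semiring

sumℤ-map-applyUpTo : ∀ (f : ℕ → ℤ) (g : ℕ → ℕ) n → sumℤ (map f (applyUpTo g n)) ≡ Σ< n (f ∘ g)
sumℤ-map-applyUpTo f g zero    = refl
sumℤ-map-applyUpTo f g (suc n) = cong (ℤ._+_ (f (g 0))) (sumℤ-map-applyUpTo f (g ∘ suc) n)

Σ≤≡Σ< : ∀ n f → Σ≤ n f ≡ Σ< (suc n) f
Σ≤≡Σ< n f = sumℤ-map-applyUpTo f id (suc n)

infixl 6 _+S_
infixr 7 _·S_

_+S_ : Series → Series → Series
(f +S g) n = f n ℤ.+ g n

negS : Series → Series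
negS f n = ℤ.- f n

_·S_ : ℤ → Series → Series
(c ·S f) n = c ℤ.* f n

tailS : Series → Series
tailS f = f ∘ suc

*S-coeff : ∀ f g n → (f *S g) n ≡ Σ< (suc n) (λ k → f k ℤ.* g (n ∸ k))
*S-coeff f g n = Σ≤≡Σ< n (λ k → f k ℤ.* g (n ∸ k))

*S-coeff-zero : ∀ f g → (f *S g) 0 ≡ f 0 ℤ.* g 0
*S-coeff-zero f g = ℤP.+-identityʳ _

*S-coeff-suc : ∀ f g n → (f *S g) (suc n) ≡ f 0 ℤ.* g (suc n) ℤ.+ (tailS f *S g) n
*S-coeff-suc f g n =
  trans (*S-coeff f g (suc n)) (cong (ℤ._+_ (f 0 ℤ.* g (suc n))) (sym (*S-coeff (tailS f) g n)))

*S-coeff-suc′ : ∀ f g n → (f *S g) (suc n) ≡ (f *S tailS g) n ℤ.+ f (suc n) ℤ.* g 0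
*S-coeff-suc′ f g n = begin
  (f *S g) (suc n)                                           ≡⟨ *S-coeff f g (suc n) ⟩
  Σ< (suc (suc n)) (λ k → f k ℤ.* g (suc n ∸ k))
    ≡⟨ Σ<-last (suc n) (λ k → f k ℤ.* g (suc n ∸ k)) ⟩
  Σ< (suc n) (λ k → f k ℤ.* g (suc n ∸ k)) ℤ.+ f (suc n) ℤ.* g (suc n ∸ suc n)
    ≡⟨ cong₂ ℤ._+_
         (Σ<-cong (suc n) λ k k<1+n → cong (λ m → f k ℤ.* g m) (ℕP.+-∸-assoc 1 (ℕP.≤-pred k<1+n)))
         (cong (λ m → f (suc n) ℤ.* g m) (ℕP.n∸n≡0 n)) ⟩
  Σ< (suc n) (λ k → f k ℤ.* tailS g (n ∸ k)) ℤ.+ f (suc n) ℤ.* g 0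
    ≡⟨ cong (ℤ._+ f (suc n) ℤ.* g 0) (sym (*S-coeff f (tailS g) n)) ⟩
  (f *S tailS g) n ℤ.+ f (suc n) ℤ.* g 0                      ∎
  where open ≡-Reasoning

*S-cong : ∀ {f f′ g g′} → f ≗ f′ → g ≗ g′ → f *S g ≗ f′ *S g′
*S-cong {f} {f′} {g} {g′} f≗f′ g≗g′ n = begin
  (f *S g) n                              ≡⟨ *S-coeff f g n ⟩
  Σ< (suc n) (λ k → f k ℤ.* g (n ∸ k))
    ≡⟨ Σ<-cong (suc n) (λ k _ → cong₂ ℤ._*_ (f≗f′ k) (g≗g′ (n ∸ k))) ⟩
  Σ< (suc n) (λ k → f′ k ℤ.* g′ (n ∸ k))  ≡⟨ *S-coeff f′ g′ n ⟨
  (f′ *S g′) n                            ∎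
  where open ≡-Reasoning

*S-congˡ : ∀ f {g g′} → g ≗ g′ → f *S g ≗ f *S g′
*S-congˡ f = *S-cong {f} (λ _ → refl)

*S-congʳ : ∀ h {f f′} → f ≗ f′ → f *S h ≗ f′ *S h
*S-congʳ h f≗f′ = *S-cong {g = h} f≗f′ (λ _ → refl)

*S-zeroˡ : ∀ f → zeroS *S f ≗ zeroS
*S-zeroˡ f n = trans (*S-coeff zeroS f n) (Σ<-zero (suc n) (λ _ _ → refl))

*S-identityˡ : ∀ f → oneS *S f ≗ f
*S-identityˡ f zero    = trans (*S-coeff-zero oneS f) (ℤP.*-identityˡ (f 0))
*S-identityˡ f (suc n) = begin
  (oneS *S f) (suc n)                  ≡⟨ *S-coeff-suc oneS f n ⟩
  1ℤ ℤ.* f (suc n) ℤ.+ (zeroS *S f) n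
    ≡⟨ cong₂ ℤ._+_ (ℤP.*-identityˡ (f (suc n))) (*S-zeroˡ f n) ⟩
  f (suc n) ℤ.+ 0ℤ                     ≡⟨ ℤP.+-identityʳ (f (suc n)) ⟩
  f (suc n)                            ∎
  where open ≡-Reasoning

*S-comm : ∀ f g → f *S g ≗ g *S f
*S-comm f g zero    =
  trans (*S-coeff-zero f g) (trans (ℤP.*-comm (f 0) (g 0)) (sym (*S-coeff-zero g f)))
*S-comm f g (suc n) = begin
  (f *S g) (suc n)                         ≡⟨ *S-coeff-suc f g n ⟩
  f 0 ℤ.* g (suc n) ℤ.+ (tailS f *S g) n
    ≡⟨ cong₂ ℤ._+_ (ℤP.*-comm (f 0) (g (suc n))) (*S-comm (tailS f) g n) ⟩
  g (suc n) ℤ.* f 0 ℤ.+ (g *S tailS f) n   ≡⟨ ℤP.+-comm (g (suc n) ℤ.* f 0) ((g *S tailS f) n) ⟩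
  (g *S tailS f) n ℤ.+ g (suc n) ℤ.* f 0   ≡⟨ *S-coeff-suc′ g f n ⟨
  (g *S f) (suc n)                         ∎
  where open ≡-Reasoning

*S-identityʳ : ∀ f → f *S oneS ≗ f
*S-identityʳ f n = trans (*S-comm f oneS n) (*S-identityˡ f n)

*S-distribʳ : ∀ h f g → (f +S g) *S h ≗ f *S h +S g *S h
*S-distribʳ h f g n = begin
  ((f +S g) *S h) n
    ≡⟨ *S-coeff (f +S g) h n ⟩
  Σ< (suc n) (λ k → (f k ℤ.+ g k) ℤ.* h (n ∸ k))
    ≡⟨ Σ<-cong (suc n) (λ k _ → ℤP.*-distribʳ-+ (h (n ∸ k)) (f k) (g k)) ⟩
  Σ< (suc n) (λ k → f k ℤ.* h (n ∸ k) ℤ.+ g k ℤ.* h (n ∸ k))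
    ≡⟨ Σ<-distrib-+ (suc n) (λ k → f k ℤ.* h (n ∸ k)) (λ k → g k ℤ.* h (n ∸ k)) ⟩
  Σ< (suc n) (λ k → f k ℤ.* h (n ∸ k)) ℤ.+ Σ< (suc n) (λ k → g k ℤ.* h (n ∸ k))
    ≡⟨ cong₂ ℤ._+_ (*S-coeff f h n) (*S-coeff g h n) ⟨
  (f *S h +S g *S h) n
    ∎
  where open ≡-Reasoning

*S-distribˡ : ∀ h f g → h *S (f +S g) ≗ h *S f +S h *S g
*S-distribˡ h f g n = begin
  (h *S (f +S g)) n              ≡⟨ *S-comm h (f +S g) n ⟩
  ((f +S g) *S h) n              ≡⟨ *S-distribʳ h f g n ⟩
  (f *S h) n ℤ.+ (g *S h) n      ≡⟨ cong₂ ℤ._+_ (*S-comm f h n) (*S-comm g h n) ⟩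
  (h *S f +S h *S g) n           ∎
  where open ≡-Reasoning

·S-*S : ∀ c f g → (c ·S f) *S g ≗ c ·S (f *S g)
·S-*S c f g n = begin
  ((c ·S f) *S g) n
    ≡⟨ *S-coeff (c ·S f) g n ⟩
  Σ< (suc n) (λ k → c ℤ.* f k ℤ.* g (n ∸ k))
    ≡⟨ Σ<-cong (suc n) (λ k _ → ℤP.*-assoc c (f k) (g (n ∸ k))) ⟩
  Σ< (suc n) (λ k → c ℤ.* (f k ℤ.* g (n ∸ k)))
    ≡⟨ *-distribˡ-Σ< (suc n) c (λ k → f k ℤ.* g (n ∸ k)) ⟨
  c ℤ.* Σ< (suc n) (λ k → f k ℤ.* g (n ∸ k))
    ≡⟨ cong (c ℤ.*_) (*S-coeff f g n) ⟨
  (c ·S (f *S g)) n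
    ∎
  where open ≡-Reasoning

tailS-*S : ∀ f g → tailS (f *S g) ≗ f 0 ·S tailS g +S tailS f *S g
tailS-*S f g = *S-coeff-suc f g

*S-assoc : ∀ f g h → (f *S g) *S h ≗ f *S (g *S h)
*S-assoc f g h zero    = begin
  ((f *S g) *S h) 0            ≡⟨ *S-coeff-zero (f *S g) h ⟩
  (f *S g) 0 ℤ.* h 0           ≡⟨ cong (ℤ._* h 0) (*S-coeff-zero f g) ⟩
  f 0 ℤ.* g 0 ℤ.* h 0          ≡⟨ ℤP.*-assoc (f 0) (g 0) (h 0) ⟩
  f 0 ℤ.* (g 0 ℤ.* h 0)        ≡⟨ cong (f 0 ℤ.*_) (*S-coeff-zero g h) ⟨
  f 0 ℤ.* (g *S h) 0           ≡⟨ *S-coeff-zero f (g *S h) ⟨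
  (f *S (g *S h)) 0            ∎
  where open ≡-Reasoning
*S-assoc f g h (suc n) = begin
  ((f *S g) *S h) (suc n)
    ≡⟨ *S-coeff-suc (f *S g) h n ⟩
  (f *S g) 0 ℤ.* h (suc n) ℤ.+ (tailS (f *S g) *S h) n
    ≡⟨ cong₂ ℤ._+_ (cong (ℤ._* h (suc n)) (*S-coeff-zero f g)) (*S-congʳ h (tailS-*S f g) n) ⟩
  f 0 ℤ.* g 0 ℤ.* h (suc n) ℤ.+ ((f 0 ·S tailS g +S tailS f *S g) *S h) n
    ≡⟨ cong (ℤ._+_ (f 0 ℤ.* g 0 ℤ.* h (suc n))) (*S-distribʳ h (f 0 ·S tailS g) (tailS f *S g) n) ⟩
  f 0 ℤ.* g 0 ℤ.* h (suc n) ℤ.+ (((f 0 ·S tailS g) *S h) n ℤ.+ ((tailS f *S g) *S h) n)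
    ≡⟨ cong (ℤ._+_ (f 0 ℤ.* g 0 ℤ.* h (suc n)))
            (cong₂ ℤ._+_ (·S-*S (f 0) (tailS g) h n) (*S-assoc (tailS f) g h n)) ⟩
  f 0 ℤ.* g 0 ℤ.* h (suc n) ℤ.+ (f 0 ℤ.* (tailS g *S h) n ℤ.+ (tailS f *S (g *S h)) n)
    ≡⟨ regroup (f 0) (g 0) (h (suc n)) ((tailS g *S h) n) ((tailS f *S (g *S h)) n) ⟩
  f 0 ℤ.* (g 0 ℤ.* h (suc n) ℤ.+ (tailS g *S h) n) ℤ.+ (tailS f *S (g *S h)) n
    ≡⟨ cong (λ x → f 0 ℤ.* x ℤ.+ (tailS f *S (g *S h)) n) (*S-coeff-suc g h n) ⟨
  f 0 ℤ.* (g *S h) (suc n) ℤ.+ (tailS f *S (g *S h)) n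
    ≡⟨ *S-coeff-suc f (g *S h) n ⟨
  (f *S (g *S h)) (suc n)
    ∎
  where
  open ≡-Reasoning
  regroup : ∀ a b c d e → a ℤ.* b ℤ.* c ℤ.+ (a ℤ.* d ℤ.+ e) ≡ a ℤ.* (b ℤ.* c ℤ.+ d) ℤ.+ e
  regroup = solve-∀

*S-zeroʳ : ∀ f → f *S zeroS ≗ zeroS
*S-zeroʳ f n = trans (*S-comm f zeroS n) (*S-zeroˡ f n)

Series-isCommutativeSemiring : IsCommutativeSemiring _≗_ _+S_ _*S_ zeroS oneS
Series-isCommutativeSemiring = record
  { isSemiring = record
    { isSemiringWithoutAnnihilatingZero = record
      { +-isCommutativeMonoid = Pointwise.isCommutativeMonoid ℕ ℤP.+-0-isCommutativeMonoid
      ; *-cong                = *S-cong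
      ; *-assoc               = *S-assoc
      ; *-identity            = *S-identityˡ , *S-identityʳ
      ; distrib               = *S-distribˡ , *S-distribʳ
      }
    ; zero = *S-zeroˡ , *S-zeroʳ
    }
  ; *-comm = *S-comm
  }

Series-commutativeSemiring : CommutativeSemiring 0ℓ 0ℓ
Series-commutativeSemiring = record { isCommutativeSemiring = Series-isCommutativeSemiring }

open CommutativeSemiring Series-commutativeSemiring using ()
  renaming (semiring to Series-semiring; setoid to Series-setoid; *-commutativeMonoid to Series-*-commutativeMonoid)
open Exp Series-semiring using (_^_)
open RangeSum Series-semiring using () renaming (Σ< to ΣS; *-distribˡ-Σ< to *S-distribˡ-ΣS)

ΣS-coeff : ∀ n F N → ΣS n F N ≡ Σ< n (λ t → F t N)
ΣS-coeff zero    F N = refl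
ΣS-coeff (suc n) F N = cong (ℤ._+_ (F 0 N)) (ΣS-coeff n (F ∘ suc) N)

mono-suc-*S-zero : ∀ a f → (mono (suc a) *S f) 0 ≡ 0ℤ
mono-suc-*S-zero a f = *S-coeff-zero (mono (suc a)) f

mono-suc-*S-suc : ∀ a f n → (mono (suc a) *S f) (suc n) ≡ (mono a *S f) n
mono-suc-*S-suc a f n = trans (*S-coeff-suc (mono (suc a)) f n) (ℤP.+-identityˡ _)

mono-*S-coeff-below : ∀ a f {n} → n < a → (mono a *S f) n ≡ 0ℤ
mono-*S-coeff-below (suc a) f {zero}  _         = mono-suc-*S-zero a f
mono-*S-coeff-below (suc a) f {suc n} (s≤s n<a) = trans (mono-suc-*S-suc a f n) (mono-*S-coeff-below a f n<a)

mono-*S-coeff-cong : ∀ a {f g} n → (∀ m → a ℕ.+ m ≤ n → f m ≡ g m) → (mono a *S f) n ≡ (mono a *S g) n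
mono-*S-coeff-cong zero    {f} {g} n       f≡g =
  trans (*S-identityˡ f n) (trans (f≡g n ℕP.≤-refl) (sym (*S-identityˡ g n)))
mono-*S-coeff-cong (suc a) {f} {g} zero    f≡g =
  trans (mono-suc-*S-zero a f) (sym (mono-suc-*S-zero a g))
mono-*S-coeff-cong (suc a) {f} {g} (suc n) f≡g = trans (mono-suc-*S-suc a f n)
  (trans (mono-*S-coeff-cong a n (λ m a+m≤n → f≡g m (s≤s a+m≤n))) (sym (mono-suc-*S-suc a g n)))

mono-+ : ∀ a b → mono (a ℕ.+ b) ≗ mono a *S mono b
mono-+ zero    b n       = sym (*S-identityˡ (mono b) n)
mono-+ (suc a) b zero    = sym (mono-suc-*S-zero a (mono b))
mono-+ (suc a) b (suc n) = trans (mono-+ a b n) (sym (mono-suc-*S-suc a (mono b) n))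

mono-^ : ∀ m → mono 1 ^ m ≗ mono m
mono-^ zero    n = refl
mono-^ (suc m) n = trans (*S-congˡ (mono 1) (mono-^ m) n) (sym (mono-+ 1 m n))

-- Multiplication by q^(k+1) only looks at lower coefficients, so x = a + q^(k+1) x determines x.
mono-fixpoint-unique : ∀ k {a x y} →
  x ≗ a +S mono (suc k) *S x → y ≗ a +S mono (suc k) *S y → x ≗ y
mono-fixpoint-unique k {a} {x} {y} x≗ y≗ = <-rec (λ n → x n ≡ y n) step
  where
  step : ∀ n → (∀ {m} → m < n → x m ≡ y m) → x n ≡ y n
  step n ih = begin
    x n                               ≡⟨ x≗ n ⟩
    a n ℤ.+ (mono (suc k) *S x) n     ≡⟨ cong (ℤ._+_ (a n)) (mono-*S-coeff-cong (suc k) n lower) ⟩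
    a n ℤ.+ (mono (suc k) *S y) n     ≡⟨ y≗ n ⟨
    y n                               ∎
    where
    open ≡-Reasoning
    lower : ∀ m → suc k ℕ.+ m ≤ n → x m ≡ y m
    lower m 1+k+m≤n = ih (ℕP.<-≤-trans (s≤s (ℕP.m≤n+m m k)) 1+k+m≤n)

invList≡applyUpTo : ∀ f n → invList f n ≡ applyUpTo (λ k → invS f (n ∸ k)) (suc n)
invList≡applyUpTo f zero    = refl
invList≡applyUpTo f (suc n) = cong (invS f (suc n) ∷_) (invList≡applyUpTo f n)

sumℤ-zipWith-* : ∀ (g : ℕ → ℤ) (u : ℕ → ℕ) (h : ℕ → ℤ) m →
  sumℤ (zipWith ℤ._*_ (map g (applyUpTo u m)) (applyUpTo h m)) ≡ Σ< m (λ k → g (u k) ℤ.* h k)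
sumℤ-zipWith-* g u h zero    = refl
sumℤ-zipWith-* g u h (suc m) = cong (ℤ._+_ (g (u 0) ℤ.* h 0)) (sumℤ-zipWith-* g (u ∘ suc) (h ∘ suc) m)

invS-suc : ∀ f n → invS f (suc n) ≡ ℤ.- Σ< (suc n) (λ k → f (suc k) ℤ.* invS f (n ∸ k))
invS-suc f n = cong ℤ.-_ (begin
  sumℤ (zipWith ℤ._*_ (map (f ∘ suc) (upTo (suc n))) (invList f n))
    ≡⟨ cong (sumℤ ∘ zipWith ℤ._*_ (map (f ∘ suc) (upTo (suc n)))) (invList≡applyUpTo f n) ⟩
  sumℤ (zipWith ℤ._*_ (map (f ∘ suc) (upTo (suc n))) (applyUpTo (λ k → invS f (n ∸ k)) (suc n)))
    ≡⟨ sumℤ-zipWith-* (f ∘ suc) id (λ k → invS f (n ∸ k)) (suc n) ⟩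
  Σ< (suc n) (λ k → f (suc k) ℤ.* invS f (n ∸ k))
    ∎)
  where open ≡-Reasoning

*S-invS : ∀ f → f 0 ≡ 1ℤ → f *S invS f ≗ oneS
*S-invS f f₀≡1 zero    = trans (*S-coeff-zero f (invS f)) (cong (ℤ._* 1ℤ) f₀≡1)
*S-invS f f₀≡1 (suc n) = begin
  (f *S invS f) (suc n)                        ≡⟨ *S-coeff-suc f (invS f) n ⟩
  f 0 ℤ.* invS f (suc n) ℤ.+ (tailS f *S invS f) n
    ≡⟨ cong₂ ℤ._+_ (cong₂ ℤ._*_ f₀≡1 (invS-suc f n)) (*S-coeff (tailS f) (invS f) n) ⟩
  1ℤ ℤ.* ℤ.- s ℤ.+ s                           ≡⟨ cong (ℤ._+ s) (ℤP.*-identityˡ (ℤ.- s)) ⟩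
  ℤ.- s ℤ.+ s                                  ≡⟨ ℤP.+-inverseˡ s ⟩
  0ℤ                                           ∎
  where
  open ≡-Reasoning
  s = Σ< (suc n) (λ k → f (suc k) ℤ.* invS f (n ∸ k))

R : ℕ → Series
R m = rpoch (+ m)

poch-coeff-zero : ∀ m → poch m 0 ≡ 1ℤ
poch-coeff-zero zero    = refl
poch-coeff-zero (suc m) =
  trans (*S-coeff-zero (poch m) (oneS -S mono (suc m))) (cong (ℤ._* 1ℤ) (poch-coeff-zero m))

poch-*S-R : ∀ m → poch m *S R m ≗ oneS
poch-*S-R m = *S-invS (poch m) (poch-coeff-zero m)

R-zero : R 0 ≗ oneS
R-zero n = trans (sym (*S-identityˡ (R 0) n)) (poch-*S-R 0 n)

-- Since (q)_{m+1} = (q)_m (1 - q^{m+1}), both sides are inverses of (q)_m.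
[1-mono]*S-R : ∀ m → (oneS -S mono (suc m)) *S R (suc m) ≗ R m
[1-mono]*S-R m = inverse-unique Series-*-commutativeMonoid
  (poch m) ((oneS -S mono (suc m)) *S R (suc m)) (R m)
  (λ n → trans (sym (*S-assoc (poch m) (oneS -S mono (suc m)) (R (suc m)) n)) (poch-*S-R (suc m) n))
  (poch-*S-R m)

negS-*S : ∀ f g → negS f *S g ≗ negS (f *S g)
negS-*S f g n = begin
  (negS f *S g) n             ≡⟨ *S-congʳ g (λ k → sym (ℤP.-1*i≡-i (f k))) n ⟩
  ((ℤ.-1ℤ ·S f) *S g) n       ≡⟨ ·S-*S ℤ.-1ℤ f g n ⟩
  ℤ.-1ℤ ℤ.* (f *S g) n        ≡⟨ ℤP.-1*i≡-i ((f *S g) n) ⟩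
  ℤ.- (f *S g) n              ∎
  where open ≡-Reasoning

R-suc : ∀ m → R (suc m) ≗ R m +S mono (suc m) *S R (suc m)
R-suc m n = begin
  R (suc m) n                                ≡⟨ cancel (R (suc m) n) ((mono (suc m) *S R (suc m)) n) ⟩
  R (suc m) n ℤ.- (mono (suc m) *S R (suc m)) n ℤ.+ (mono (suc m) *S R (suc m)) n
    ≡⟨ cong (ℤ._+ (mono (suc m) *S R (suc m)) n) (begin
         R (suc m) n ℤ.- (mono (suc m) *S R (suc m)) n
           ≡⟨ cong₂ ℤ._+_ (*S-identityˡ (R (suc m)) n) (negS-*S (mono (suc m)) (R (suc m)) n) ⟨
         (oneS *S R (suc m)) n ℤ.+ (negS (mono (suc m)) *S R (suc m)) n
           ≡⟨ *S-distribʳ (R (suc m)) oneS (negS (mono (suc m))) n ⟨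
         ((oneS -S mono (suc m)) *S R (suc m)) n
           ≡⟨ [1-mono]*S-R m n ⟩
         R m n ∎) ⟩
  R m n ℤ.+ (mono (suc m) *S R (suc m)) n    ∎
  where
  open ≡-Reasoning
  cancel : ∀ a b → a ≡ a ℤ.- b ℤ.+ b
  cancel = solve-∀

+S-mono-^ : ∀ k a x → a +S mono (suc k) *S x ≗ a +S (mono 1 ^ suc k) *S x
+S-mono-^ k a x n = cong (ℤ._+_ (a n)) (*S-congʳ x (λ i → sym (mono-^ (suc k) i)) n)

R-suc-^ : ∀ m → R (suc m) ≗ R m +S (mono 1 ^ suc m) *S R (suc m)
R-suc-^ m n = trans (R-suc m n) (+S-mono-^ m (R m) (R (suc m)) n)

mono-^-fixpoint-unique : ∀ k {a x y} →
  x ≗ a +S (mono 1 ^ suc k) *S x → y ≗ a +S (mono 1 ^ suc k) *S y → x ≗ y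
mono-^-fixpoint-unique k {a} {x} {y} x≗ y≗ = mono-fixpoint-unique k {a}
  (λ n → trans (x≗ n) (sym (+S-mono-^ k a x n))) (λ n → trans (y≗ n) (sym (+S-mono-^ k a y n)))

open QChuVandermonde.WithReciprocals
  Series-commutativeSemiring (mono 1) R R-zero R-suc-^ mono-^-fixpoint-unique
  using (cvTerm; cvSum; cvSum-closed)

rpoch-nonneg : ∀ {m n} → n ≤ m → rpoch (+ m ℤ.- + n) ≡ R (m ∸ n)
rpoch-nonneg {m} {n} n≤m = cong rpoch (trans (ℤP.m-n≡m⊖n m n) (ℤP.⊖-≥ n≤m))

rpoch-neg : ∀ {m n} → m < n → rpoch (+ m ℤ.- + n) ≡ zeroS
rpoch-neg {m} {n} m<n =
  trans (cong rpoch (trans (ℤP.m-n≡m⊖n m n) (ℤP.⊖-< m<n))) (rpoch-neg-suc (ℕP.m<n⇒0<n∸m m<n))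
  where
  rpoch-neg-suc : ∀ {k} → 0 < k → rpoch (ℤ.- + k) ≡ zeroS
  rpoch-neg-suc {suc _} _ = refl

zero-*S : ∀ g {f} → f ≗ zeroS → f *S g ≗ zeroS
zero-*S g {f} f≗0 n = trans (*S-congʳ g f≗0 n) (*S-zeroˡ g n)

*S-zero : ∀ f {g} → g ≗ zeroS → f *S g ≗ zeroS
*S-zero f {g} g≗0 n = trans (*S-congˡ f g≗0 n) (*S-zeroʳ f n)

lhsTerm-vanishes-large-k : ∀ i j k → i ℕ.+ j < k → lhsTerm i j k ≗ zeroS
lhsTerm-vanishes-large-k i j k i+j<k =
  *S-zero (mono (sq i ℕ.+ sq j ℕ.+ sq k)) (zero-*S _ (cong-app (rpoch-neg i+j<k)))

lhsTerm-vanishes-large-i : ∀ i j k → j ℕ.+ k < i → lhsTerm i j k ≗ zeroS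
lhsTerm-vanishes-large-i i j k j+k<i =
  *S-zero (mono (sq i ℕ.+ sq j ℕ.+ sq k))
    (*S-zero (rpoch (+ i ℤ.+ + j ℤ.- + k)) (*S-zero (rpoch (+ i ℤ.+ + k ℤ.- + j)) (cong-app (rpoch-neg j+k<i))))

lhsTerm-coeff-vanishes : ∀ i j {k N} → N < k → lhsTerm i j k N ≡ 0ℤ
lhsTerm-coeff-vanishes i j {suc k} N<k = mono-*S-coeff-below (sq i ℕ.+ sq j ℕ.+ sq (suc k))
  (rpoch (+ i ℤ.+ + j ℤ.- + suc k) *S (rpoch (+ i ℤ.+ + suc k ℤ.- + j) *S rpoch (+ j ℤ.+ + suc k ℤ.- + i)))
  (ℕP.<-≤-trans N<k (ℕP.≤-trans (ℕP.m≤m*n (suc k) (suc k)) (ℕP.m≤n+m (sq (suc k)) (sq i ℕ.+ sq j))))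

lhsTerm-sym : ∀ i j k → lhsTerm i j k ≗ lhsTerm j i k
lhsTerm-sym i j k = *S-cong (λ n → cong (λ e → mono (e ℕ.+ sq k) n) (ℕP.+-comm (sq i) (sq j)))
  (*S-cong (λ n → cong (λ l → rpoch (+ l ℤ.- + k) n) (ℕP.+-comm i j))
           (*S-comm (rpoch (+ i ℤ.+ + k ℤ.- + j)) (rpoch (+ j ℤ.+ + k ℤ.- + i))))

rhsTerm-sym : ∀ i j → rhsTerm i j ≗ rhsTerm j i
rhsTerm-sym i j = *S-cong
  (λ n → cong₂ (λ e l → mono (e ℕ.+ sq l) n) (ℕP.+-comm (sq i) (sq j)) (ℕP.+-comm (i ∸ j) (j ∸ i)))
  (*S-comm (rpoch (+ (2 ℕ.* i))) (rpoch (+ (2 ℕ.* j))))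

lhsTerm-cvTerm : ∀ j d t → t ≤ j ℕ.+ j →
  lhsTerm (j ℕ.+ d) j (d ℕ.+ t) ≗ mono (sq (j ℕ.+ d) ℕ.+ sq j ℕ.+ sq d) *S cvTerm (j ℕ.+ j) (d ℕ.+ d) t
lhsTerm-cvTerm j d t t≤2j = begin
  mono E *S (rpoch (+ (j ℕ.+ d ℕ.+ j) ℤ.- + (d ℕ.+ t))
            *S (rpoch (+ (j ℕ.+ d ℕ.+ (d ℕ.+ t)) ℤ.- + j) *S rpoch (+ (j ℕ.+ (d ℕ.+ t)) ℤ.- + (j ℕ.+ d))))
    ≡⟨ cong₂ (λ a bc → mono E *S (a *S bc))
         (trans (cong rpoch (i+j-k≡2j-t (+ j) (+ d) (+ t))) (rpoch-nonneg t≤2j))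
         (cong₂ _*S_ (cong rpoch (i+k-j≡2d+t (+ j) (+ d) (+ t))) (cong rpoch (j+k-i≡t (+ j) (+ d) (+ t)))) ⟩
  mono E *S Y
    ≈⟨ *S-congʳ Y (λ n → trans (cong (λ e → mono e n) (exponent j d t)) (mono-+ B X n)) ⟩
  (mono B *S mono X) *S Y   ≈⟨ *S-assoc (mono B) (mono X) Y ⟩
  mono B *S (mono X *S Y)   ≈⟨ *S-congˡ (mono B) (*S-congʳ Y (λ n → sym (mono-^ X n))) ⟩
  mono B *S cvTerm (j ℕ.+ j) (d ℕ.+ d) t ∎
  where
  open SetoidReasoning Series-setoid
  E = sq (j ℕ.+ d) ℕ.+ sq j ℕ.+ sq (d ℕ.+ t)
  B = sq (j ℕ.+ d) ℕ.+ sq j ℕ.+ sq d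
  X = t ℕ.* t ℕ.+ (d ℕ.+ d) ℕ.* t
  Y = R (j ℕ.+ j ∸ t) *S (R (d ℕ.+ d ℕ.+ t) *S R t)
  exponent : ∀ j d t → (j ℕ.+ d) ℕ.* (j ℕ.+ d) ℕ.+ j ℕ.* j ℕ.+ (d ℕ.+ t) ℕ.* (d ℕ.+ t) ≡
    ((j ℕ.+ d) ℕ.* (j ℕ.+ d) ℕ.+ j ℕ.* j ℕ.+ d ℕ.* d) ℕ.+ (t ℕ.* t ℕ.+ (d ℕ.+ d) ℕ.* t)
  exponent = ℕ-solve-∀
  i+j-k≡2j-t : ∀ j d t → j ℤ.+ d ℤ.+ j ℤ.- (d ℤ.+ t) ≡ j ℤ.+ j ℤ.- t
  i+j-k≡2j-t = solve-∀
  i+k-j≡2d+t : ∀ j d t → j ℤ.+ d ℤ.+ (d ℤ.+ t) ℤ.- j ≡ d ℤ.+ d ℤ.+ t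
  i+k-j≡2d+t = solve-∀
  j+k-i≡t : ∀ j d t → j ℤ.+ (d ℤ.+ t) ℤ.- (j ℤ.+ d) ≡ t
  j+k-i≡t = solve-∀

rhsTerm-closed : ∀ j d →
  mono (sq (j ℕ.+ d) ℕ.+ sq j ℕ.+ sq d) *S (R (j ℕ.+ j) *S R (j ℕ.+ j ℕ.+ (d ℕ.+ d))) ≗ rhsTerm (j ℕ.+ d) j
rhsTerm-closed j d = *S-cong
  (λ n → cong (λ e → mono (sq (j ℕ.+ d) ℕ.+ sq j ℕ.+ sq e) n) (sym dist≡d))
  (λ n → trans (*S-comm (R (j ℕ.+ j)) (R (j ℕ.+ j ℕ.+ (d ℕ.+ d))) n)
               (cong₂ (λ a b → (R a *S R b) n) (twice-sum j d) (twice j)))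
  where
  dist≡d : dist (j ℕ.+ d) j ≡ d
  dist≡d = trans (cong₂ ℕ._+_ (ℕP.m+n∸m≡n j d) (ℕP.m≤n⇒m∸n≡0 (ℕP.m≤m+n j d))) (ℕP.+-identityʳ d)
  twice-sum : ∀ j d → j ℕ.+ j ℕ.+ (d ℕ.+ d) ≡ 2 ℕ.* (j ℕ.+ d)
  twice-sum = ℕ-solve-∀
  twice : ∀ j → j ℕ.+ j ≡ 2 ℕ.* j
  twice = ℕ-solve-∀

Σ≤-cong : ∀ n {f g} → f ≗ g → Σ≤ n f ≡ Σ≤ n g
Σ≤-cong n f≗g = cong sumℤ (map-cong f≗g (upTo (suc n)))

lhsTerm-sum-truncate : ∀ i j N →
  Σ≤ N (λ k → lhsTerm i j k N) ≡ Σ< (suc (i ℕ.+ j)) (λ k → lhsTerm i j k N)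
lhsTerm-sum-truncate i j N = trans (Σ≤≡Σ< N (λ k → lhsTerm i j k N))
  (Σ<-bound-irrelevant (suc N) (suc (i ℕ.+ j)) (λ k → lhsTerm i j k N)
    (λ k N<k → lhsTerm-coeff-vanishes i j N<k) (λ k i+j<k → lhsTerm-vanishes-large-k i j k i+j<k N))

lhsTerm-sum-diagonal-offset : ∀ j d N →
  Σ≤ N (λ k → lhsTerm (j ℕ.+ d) j k N) ≡ rhsTerm (j ℕ.+ d) j N
lhsTerm-sum-diagonal-offset j d N = begin
  Σ≤ N f                                          ≡⟨ lhsTerm-sum-truncate (j ℕ.+ d) j N ⟩
  Σ< (suc (j ℕ.+ d ℕ.+ j)) f                      ≡⟨ cong (λ l → Σ< l f) (range j d) ⟩
  Σ< (d ℕ.+ suc (j ℕ.+ j)) f                      ≡⟨ Σ<-split d (suc (j ℕ.+ j)) f ⟩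
  Σ< d f ℤ.+ Σ< (suc (j ℕ.+ j)) (λ t → f (d ℕ.+ t))
    ≡⟨ cong₂ ℤ._+_ (Σ<-zero d {f} (λ k k<d → lhsTerm-vanishes-large-i (j ℕ.+ d) j k (ℕP.+-monoʳ-< j k<d) N))
                   (Σ<-cong (suc (j ℕ.+ j)) (λ t t≤2j → lhsTerm-cvTerm j d t (ℕP.≤-pred t≤2j) N)) ⟩
  0ℤ ℤ.+ Σ< (suc (j ℕ.+ j)) (λ t → (mono B *S cvTerm (j ℕ.+ j) (d ℕ.+ d) t) N)
    ≡⟨ ℤP.+-identityˡ _ ⟩
  Σ< (suc (j ℕ.+ j)) (λ t → (mono B *S cvTerm (j ℕ.+ j) (d ℕ.+ d) t) N)
    ≡⟨ ΣS-coeff (suc (j ℕ.+ j)) (λ t → mono B *S cvTerm (j ℕ.+ j) (d ℕ.+ d) t) N ⟨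
  ΣS (suc (j ℕ.+ j)) (λ t → mono B *S cvTerm (j ℕ.+ j) (d ℕ.+ d) t) N
    ≡⟨ *S-distribˡ-ΣS (suc (j ℕ.+ j)) (mono B) (cvTerm (j ℕ.+ j) (d ℕ.+ d)) N ⟨
  (mono B *S cvSum (j ℕ.+ j) (d ℕ.+ d)) N
    ≡⟨ *S-congˡ (mono B) (cvSum-closed (j ℕ.+ j) (d ℕ.+ d)) N ⟩
  (mono B *S (R (j ℕ.+ j) *S R (j ℕ.+ j ℕ.+ (d ℕ.+ d)))) N
    ≡⟨ rhsTerm-closed j d N ⟩
  rhsTerm (j ℕ.+ d) j N ∎
  where
  open ≡-Reasoning
  f = λ k → lhsTerm (j ℕ.+ d) j k N
  B = sq (j ℕ.+ d) ℕ.+ sq j ℕ.+ sq d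
  range : ∀ j d → suc (j ℕ.+ d ℕ.+ j) ≡ d ℕ.+ suc (j ℕ.+ j)
  range = ℕ-solve-∀

lhsTerm-sum-≥ : ∀ {i j} → j ≤ i → ∀ N → Σ≤ N (λ k → lhsTerm i j k N) ≡ rhsTerm i j N
lhsTerm-sum-≥ {i} {j} j≤i N = subst (λ i → Σ≤ N (λ k → lhsTerm i j k N) ≡ rhsTerm i j N)
  (ℕP.m+[n∸m]≡n j≤i) (lhsTerm-sum-diagonal-offset j (i ∸ j) N)

lhsTerm-sum : ∀ i j N → Σ≤ N (λ k → lhsTerm i j k N) ≡ rhsTerm i j N
lhsTerm-sum i j N with ℕP.≤-total j i
... | inj₁ j≤i = lhsTerm-sum-≥ j≤i N
... | inj₂ i≤j = begin
  Σ≤ N (λ k → lhsTerm i j k N)   ≡⟨ Σ≤-cong N (λ k → lhsTerm-sym i j k N) ⟩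
  Σ≤ N (λ k → lhsTerm j i k N)   ≡⟨ lhsTerm-sum-≥ i≤j N ⟩
  rhsTerm j i N                  ≡⟨ rhsTerm-sym j i N ⟩
  rhsTerm i j N                  ∎
  where open ≡-Reasoning

mainTheorem16 : (N : ℕ) → LHS N ≡ RHS N
mainTheorem16 N = Σ≤-cong N (λ i → Σ≤-cong N (λ j → lhsTerm-sum i j N))
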